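{- For equivalence relations $R,S$ on $\omega$: $R\mid_d S$ holds if and only if $R$ and $S$ are mutually dark.
   Context: For a Turing degree $\mathbf{d}$, $R\leq_{\mathbf{d}} S$ means there is a total $\mathbf{d}$-computable $f$ with $x\mathrel{R}y\Leftrightarrow f(x)\mathrel{S}f(y)$ for all $x,y$. $R\mid_d S$ means: $R$ and $S$ both have infinitely many equivalence classes, $R\not\leq_{\deg_T(R)}S$ and $S\not\leq_{\deg_T(S)}R$ (equivalence relations viewed as subsets of $\omega$ via a computable pairing function). For $A\subseteq\omega$, $R$ is $A$-dark if $R$ has infinitely many classes and there is no infinite $A$-c.e. set $W$ with $u\not\mathrel{R}v$ for all distinct $u,v\in W$. $R,S$ are mutually dark if $R$ is $S$-dark and $S$ is $R$-dark. -}

module Defs where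

open import Data.Nat using (ℕ; zero; suc; _≤_)
open import Data.Bool using (Bool; true; false; if_then_else_)
open import Data.Fin using (Fin)
open import Data.Vec using (Vec; []; _∷_)
open import Data.List using (List)
open import Data.List.Relation.Unary.All using (All)
open import Data.Product using (Σ; ∃; _×_; _,_; proj₁; proj₂)
open import Relation.Binary.PropositionalEquality using (_≡_; _≢_)
open import Relation.Nullary using (¬_)

-- Computable pairing: a computable bijection ℕ ≅ ℕ × ℕ enumerating
-- pairs along diagonals (0,0),(1,0),(0,1),(2,0),(1,1),(0,2),...
-- We give the decoding direction, which is all that is needed to view
-- a binary relation as a subset of ω (n ∈ R iff unpair n ∈ R).

unpair : ℕ → ℕ × ℕ
unpair zero = 0 , 0
unpair (suc n) with unpair n
... | zero , y = suc y , 0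
... | suc x , y = x , suc y

Oracle : Set
Oracle = ℕ → Bool

asSet : (ℕ → ℕ → Bool) → Oracle
asSet R n = R (proj₁ (unpair n)) (proj₂ (unpair n))

data PR : ℕ → Set where
  zer  : ∀ {n} → PR n
  scc  : PR 1
  proj : ∀ {n} → Fin n → PR n
  orc  : PR 1
  comp : ∀ {n m} → PR m → Vec (PR n) m → PR n
  prec : ∀ {n} → PR n → PR (suc (suc n)) → PR (suc n)
  mu   : ∀ {n} → PR (suc n) → PR n

mutual
  data Eval (A : Oracle) : ∀ {n} → PR n → Vec ℕ n → ℕ → Set where
    ev-zer  : ∀ {n} {xs : Vec ℕ n} → Eval A zer xs 0
    ev-scc  : ∀ {x} → Eval A scc (x ∷ []) (suc x)
    ev-proj : ∀ {n} (i : Fin n) {xs : Vec ℕ n} →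
              Eval A (proj i) xs (Data.Vec.lookup xs i)
    ev-orc  : ∀ {x} → Eval A orc (x ∷ []) (if A x then 1 else 0)
    ev-comp : ∀ {n m} {f : PR m} {gs : Vec (PR n) m} {xs : Vec ℕ n}
              {ys : Vec ℕ m} {y : ℕ} →
              EvalVec A gs xs ys → Eval A f ys y → Eval A (comp f gs) xs y
    ev-prec0 : ∀ {n} {g : PR n} {h : PR (suc (suc n))} {xs : Vec ℕ n} {y} →
               Eval A g xs y → Eval A (prec g h) (0 ∷ xs) y
    ev-precS : ∀ {n} {g : PR n} {h : PR (suc (suc n))} {xs : Vec ℕ n}
               {k z y} →
               Eval A (prec g h) (k ∷ xs) z → Eval A h (k ∷ z ∷ xs) y →
               Eval A (prec g h) (suc k ∷ xs) y
    ev-mu   : ∀ {n} {f : PR (suc n)} {xs : Vec ℕ n} {y} →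
              MuFrom A f xs 0 y → Eval A (mu f) xs y

  data EvalVec (A : Oracle) {n : ℕ} : ∀ {m} → Vec (PR n) m → Vec ℕ n → Vec ℕ m → Set where
    evv-[] : ∀ {xs} → EvalVec A [] xs []
    evv-∷  : ∀ {m} {g : PR n} {gs : Vec (PR n) m} {xs y ys} →
             Eval A g xs y → EvalVec A gs xs ys → EvalVec A (g ∷ gs) xs (y ∷ ys)

  data MuFrom (A : Oracle) {n : ℕ} (f : PR (suc n)) (xs : Vec ℕ n) : ℕ → ℕ → Set where
    mu-stop : ∀ {i} → Eval A f (i ∷ xs) 0 → MuFrom A f xs i i
    mu-step : ∀ {i k y} → Eval A f (i ∷ xs) (suc k) →
              MuFrom A f xs (suc i) y → MuFrom A f xs i y

Computable : Oracle → (ℕ → ℕ) → Set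
Computable A f = Σ (PR 1) λ e → ∀ x → Eval A e (x ∷ []) (f x)

W : Oracle → PR 1 → ℕ → Set
W A e x = ∃ λ y → Eval A e (x ∷ []) y

Infinite : (ℕ → Set) → Set
Infinite P = ∀ n → ∃ λ x → n ≤ x × P x

record IsEquivRel (R : ℕ → ℕ → Bool) : Set where
  field
    refl  : ∀ x → R x x ≡ true
    sym   : ∀ x y → R x y ≡ true → R y x ≡ true
    trans : ∀ x y z → R x y ≡ true → R y z ≡ true → R x z ≡ true

InfClasses : (ℕ → ℕ → Bool) → Set
InfClasses R = ∀ (l : List ℕ) → ∃ λ x → All (λ y → R x y ≡ false) l

-- R ≤_d S with d = deg_T(A): a total A-computable reduction.
Reduces : Oracle → (ℕ → ℕ → Bool) → (ℕ → ℕ → Bool) → Set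
Reduces A R S = Σ (ℕ → ℕ) λ f → Computable A f × (∀ x y → R x y ≡ S (f x) (f y))

DIncomparable : (ℕ → ℕ → Bool) → (ℕ → ℕ → Bool) → Set
DIncomparable R S =
  InfClasses R × InfClasses S ×
  ¬ Reduces (asSet R) R S × ¬ Reduces (asSet S) S R

Dark : Oracle → (ℕ → ℕ → Bool) → Set
Dark A R = InfClasses R ×
  ¬ (Σ (PR 1) λ e → Infinite (W A e) ×
       (∀ u v → W A e u → W A e v → u ≢ v → R u v ≡ false))

MutuallyDark : (ℕ → ℕ → Bool) → (ℕ → ℕ → Bool) → Set
MutuallyDark R S = Dark (asSet S) R × Dark (asSet R) S

module Submission where

-- If f reduces R to S computably in R, the f-images of the least elements of the R-classes form
-- an R-c.e. set (u is enumerated once some x with f x = u is seen to be least in its class) that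
-- is infinite and pairwise S-inequivalent, so S is not R-dark. Conversely, an infinite S-c.e. set
-- of pairwise R-inequivalent numbers has an S-computable strictly increasing enumeration
-- w₀ < w₁ < ⋯, found by dovetailing a step-bounded interpreter, and x ↦ w_k, with k the least
-- element of the S-class of x, reduces S to R. So R ≰ S in deg(R) exactly when S is R-dark, and
-- symmetrically.

open import Defs
open import Data.Bool using (Bool; true; false; if_then_else_)
open import Data.Bool.Properties using (not-¬)
open import Data.Empty using (⊥; ⊥-elim)
open import Data.Fin using (Fin; #_; _↑ʳ_; toℕ; fromℕ<)
import Data.Fin as Fin
open import Data.Fin.Properties using (any?; pigeonhole; toℕ-fromℕ<)
open import Data.List using (List; []; _∷_)
open import Data.List.Membership.Propositional using (_∈_)
import Data.List.Relation.Unary.All as All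
open import Data.List.Relation.Unary.Any using (here; there)
open import Data.Nat using (ℕ; zero; suc; pred; ≢-nonZero; _+_; _∸_; _≤_; _<_; z≤n; s≤s; _⊔_; _≤?_)
open import Data.Nat.GeneralisedArithmetic using (fold)
open import Data.Nat.Properties
open import Data.Product using (Σ; ∃; ∃₂; _×_; _,_; proj₁; proj₂)
open import Data.Sum using (_⊎_; inj₁; inj₂)
open import Data.Vec using (Vec; []; _∷_; _++_; lookup; tabulate)
open import Data.Vec.Properties using (tabulate∘lookup; tabulate-cong; lookup-++ʳ)
open import Function.Bundles using (_⇔_; mk⇔)
open import Relation.Binary using (tri<; tri≈; tri>)
open import Relation.Binary.PropositionalEquality
open import Relation.Nullary using (yes; no)

ifz : ℕ → ℕ → ℕ → ℕ
ifz zero    b c = b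
ifz (suc _) b c = c

LeastRoot : (ℕ → ℕ) → Set
LeastRoot F = Σ ℕ λ y → F y ≡ 0 × (∀ i → i < y → F i ≢ 0)

noRootBelow-or-leastRoot : ∀ F n → (∀ i → i < n → F i ≢ 0) ⊎ LeastRoot F
noRootBelow-or-leastRoot F zero = inj₁ λ _ ()
noRootBelow-or-leastRoot F (suc n) with noRootBelow-or-leastRoot F n
... | inj₂ root = inj₂ root
... | inj₁ below with F n in Fn
...   | zero  = inj₂ (n , Fn , below)
...   | suc _ = inj₁ λ i i<1+n → case (m<1+n⇒m<n∨m≡n i<1+n)
  where
  case : ∀ {i} → i < n ⊎ i ≡ n → F i ≢ 0
  case (inj₁ i<n) = below _ i<n
  case (inj₂ refl) Fi≡0 with () ← trans (sym Fn) Fi≡0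

leastRoot : ∀ {F} → ∃ (λ y → F y ≡ 0) → LeastRoot F
leastRoot {F} (y , Fy≡0) with noRootBelow-or-leastRoot F (suc y)
... | inj₁ below = ⊥-elim (below y ≤-refl Fy≡0)
... | inj₂ root  = root

separated⇒unbounded : (g : ℕ → ℕ) → (∀ {i j} → i < j → g i ≢ g j) → ∀ n → ∃ λ i → n ≤ g i
separated⇒unbounded g sep n with any? (λ (i : Fin (suc n)) → n ≤? g (toℕ i))
... | yes (i , n≤gi) = toℕ i , n≤gi
... | no  none = ⊥-elim (collision (pigeonhole ≤-refl (λ i → fromℕ< (below i))))
  where
  open ≡-Reasoning
  below : ∀ i → g (toℕ i) < n
  below i = ≰⇒> (λ n≤gi → none (i , n≤gi))
  collision : ∃₂ (λ i j → i Fin.< j × fromℕ< (below i) ≡ fromℕ< (below j)) → ⊥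
  collision (i , j , i<j , same) = sep i<j (begin
      g (toℕ i)                ≡⟨ toℕ-fromℕ< (below i) ⟨
      toℕ (fromℕ< (below i))   ≡⟨ cong toℕ same ⟩
      toℕ (fromℕ< (below j))   ≡⟨ toℕ-fromℕ< (below j) ⟩
      g (toℕ j)                ∎)

Eventually : (ℕ → Set) → Set
Eventually P = ∃ λ T → ∀ t → T ≤ t → P t

eventually-× : ∀ {P Q : ℕ → Set} → Eventually P → Eventually Q → Eventually (λ t → P t × Q t)
eventually-× (T , p) (T′ , q) =
  T ⊔ T′ , λ t T⊔T′≤t → p t (≤-trans (m≤m⊔n T T′) T⊔T′≤t)
                     , q t (≤-trans (m≤n⊔m T T′) T⊔T′≤t)

eventually-map : ∀ {P Q : ℕ → Set} → (∀ {t} → P t → Q t) → Eventually P → Eventually Q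
eventually-map f (T , p) = T , λ t T≤t → f (p t T≤t)

χ : Bool → ℕ
χ b = if b then 1 else 0

dist≡0⇒≡ : ∀ m n → (m ∸ n) + (n ∸ m) ≡ 0 → m ≡ n
dist≡0⇒≡ m n sum≡0 = ≤-antisym (m∸n≡0⇒m≤n (m+n≡0⇒m≡0 (m ∸ n) sum≡0))
                               (m∸n≡0⇒m≤n (m+n≡0⇒n≡0 (m ∸ n) sum≡0))

dist-self : ∀ n → (n ∸ n) + (n ∸ n) ≡ 0
dist-self n rewrite n∸n≡0 n = refl

anyRootBelow : (ℕ → ℕ) → ℕ → ℕ
anyRootBelow F zero    = 1
anyRootBelow F (suc k) = ifz (anyRootBelow F k) 0 (F k)

anyRootBelow≡0⇒root : ∀ F k → anyRootBelow F k ≡ 0 → ∃ λ i → F i ≡ 0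
anyRootBelow≡0⇒root F (suc k) eq with anyRootBelow F k in earlier
... | zero  = anyRootBelow≡0⇒root F k earlier
... | suc _ = k , eq

anyRootBelow-root : ∀ F {i k} → F i ≡ 0 → i < k → anyRootBelow F k ≡ 0
anyRootBelow-root F {i} {suc k} Fi≡0 i<1+k with m<1+n⇒m<n∨m≡n i<1+k
... | inj₁ i<k rewrite anyRootBelow-root F Fi≡0 i<k = refl
... | inj₂ refl with anyRootBelow F i
...   | zero  = refl
...   | suc _ = Fi≡0

fold-increasing : ∀ (s : ℕ → ℕ) z → (∀ b → b < s b) → ∀ {i j} → i < j → fold z s i < fold z s j
fold-increasing s z s-inflationary {i} {suc j} i<1+j with m<1+n⇒m<n∨m≡n i<1+j
... | inj₁ i<j = <-trans (fold-increasing s z s-inflationary i<j) (s-inflationary _)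
... | inj₂ refl = s-inflationary _

fold-injective : ∀ (s : ℕ → ℕ) z → (∀ b → b < s b) → ∀ {i j} → fold z s i ≡ fold z s j → i ≡ j
fold-injective s z s-inflationary {i} {j} same with <-cmp i j
... | tri< i<j _ _ = ⊥-elim (<-irrefl same (fold-increasing s z s-inflationary i<j))
... | tri≈ _ i≡j _ = i≡j
... | tri> _ _ j<i = ⊥-elim (<-irrefl (sym same) (fold-increasing s z s-inflationary j<i))

-- Cantor pairing

tri : ℕ → ℕ
tri zero    = 0
tri (suc d) = suc (tri d + d)

pair : ℕ → ℕ → ℕ
pair z x = tri (z + x) + x

mutual
  unpair-tri : ∀ d → unpair (tri d) ≡ (d , 0)
  unpair-tri zero = refl
  unpair-tri (suc d) rewrite unpair-tri+ d d 0 refl = refl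

  unpair-tri+ : ∀ d y x → x + y ≡ d → unpair (tri d + y) ≡ (x , y)
  unpair-tri+ d zero    x x+0≡d rewrite +-identityʳ (tri d) | unpair-tri d | sym x+0≡d | +-identityʳ x = refl
  unpair-tri+ d (suc y) x x+1+y≡d
    rewrite +-suc (tri d) y | unpair-tri+ d y (suc x) (trans (sym (+-suc x y)) x+1+y≡d) = refl

unpair-pair : ∀ z x → unpair (pair z x) ≡ (z , x)
unpair-pair z x = unpair-tri+ (z + x) x z refl

asSet-pair : ∀ (R : ℕ → ℕ → Bool) z x → asSet R (pair z x) ≡ R z x
asSet-pair R z x = cong (λ p → R (proj₁ p) (proj₂ p)) (unpair-pair z x)

`one : ∀ {n} → PR n
`one = comp scc (zer ∷ [])

`pred : PR 1
`pred = prec zer (proj (# 0))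

shift : ∀ k {n} → Vec (PR (k + n)) n
shift k = tabulate (λ i → proj (k ↑ʳ i))

`ifz : ∀ {n} → PR n → PR n → PR n → PR n
`ifz a b c = comp (prec b (comp c (shift 2))) (a ∷ shift 0)

`add : PR 2
`add = prec (proj (# 0)) (comp scc (proj (# 1) ∷ []))

-- arguments in the order (y , x), to recurse on y
`monus : PR 2
`monus = prec (proj (# 0)) (comp `pred (proj (# 1) ∷ []))

`dist : ∀ {n} → PR n → PR n → PR n
`dist a b = comp `add (comp `monus (b ∷ a ∷ []) ∷ comp `monus (a ∷ b ∷ []) ∷ [])

`tri : PR 1
`tri = prec zer (comp scc (comp `add (proj (# 1) ∷ proj (# 0) ∷ []) ∷ []))

`pair : PR 2
`pair = comp `add (comp `tri (comp `add (proj (# 0) ∷ proj (# 1) ∷ []) ∷ []) ∷ proj (# 1) ∷ [])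

`query : ∀ {n} → PR n → PR n → PR n
`query a b = comp orc (comp `pair (a ∷ b ∷ []) ∷ [])

`anyRootBelow : ∀ {n} → PR (suc n) → PR (suc n)
`anyRootBelow f = prec `one (`ifz (proj (# 1)) zer (comp f (proj (# 0) ∷ shift 2)))

module Programs (A : Oracle) where

  Computes : ∀ {n} → PR n → (Vec ℕ n → ℕ) → Set
  Computes {n} c F = ∀ (xs : Vec ℕ n) → Eval A c xs (F xs)

  mutual
    Eval-functional : ∀ {n} {c : PR n} {xs y y′} → Eval A c xs y → Eval A c xs y′ → y ≡ y′
    Eval-functional ev-zer         ev-zer         = refl
    Eval-functional ev-scc         ev-scc         = refl
    Eval-functional (ev-proj i)    (ev-proj .i)   = refl
    Eval-functional ev-orc         ev-orc         = refl
    Eval-functional (ev-comp v e)  (ev-comp v′ e′) with refl ← EvalVec-functional v v′ = Eval-functional e e′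
    Eval-functional (ev-prec0 e)   (ev-prec0 e′)  = Eval-functional e e′
    Eval-functional (ev-precS e h) (ev-precS e′ h′) with refl ← Eval-functional e e′ = Eval-functional h h′
    Eval-functional (ev-mu m)      (ev-mu m′)     = MuFrom-functional m m′

    EvalVec-functional : ∀ {n m} {gs : Vec (PR n) m} {xs ys ys′} →
                         EvalVec A gs xs ys → EvalVec A gs xs ys′ → ys ≡ ys′
    EvalVec-functional evv-[]       evv-[]         = refl
    EvalVec-functional (evv-∷ e v) (evv-∷ e′ v′) = cong₂ _∷_ (Eval-functional e e′) (EvalVec-functional v v′)

    MuFrom-functional : ∀ {n} {f : PR (suc n)} {xs i y y′} →
                        MuFrom A f xs i y → MuFrom A f xs i y′ → y ≡ y′
    MuFrom-functional (mu-stop e)   (mu-stop e′)    = refl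
    MuFrom-functional (mu-stop e)   (mu-step e′ m′) with () ← Eval-functional e e′
    MuFrom-functional (mu-step e m) (mu-stop e′)    with () ← Eval-functional e e′
    MuFrom-functional (mu-step e m) (mu-step e′ m′) = MuFrom-functional m m′

  MuFrom-root : ∀ {n} {f : PR (suc n)} {xs i y} → MuFrom A f xs i y → Eval A f (y ∷ xs) 0
  MuFrom-root (mu-stop e)   = e
  MuFrom-root (mu-step e m) = MuFrom-root m

  eval-projs : ∀ {m n} (p : Fin m → Fin n) (xs : Vec ℕ n) →
               EvalVec A (tabulate (λ i → proj (p i))) xs (tabulate (λ i → lookup xs (p i)))
  eval-projs {zero}  p xs = evv-[]
  eval-projs {suc m} p xs = evv-∷ (ev-proj (p Fin.zero)) (eval-projs (λ i → p (Fin.suc i)) xs)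

  eval-shift : ∀ {k n} (ys : Vec ℕ k) (xs : Vec ℕ n) → EvalVec A (shift k) (ys ++ xs) xs
  eval-shift {k} ys xs = subst (EvalVec A (shift k) (ys ++ xs))
    (trans (tabulate-cong (lookup-++ʳ ys xs)) (tabulate∘lookup xs))
    (eval-projs (k ↑ʳ_) (ys ++ xs))

  eval-one : ∀ {n} (xs : Vec ℕ n) → Eval A `one xs 1
  eval-one xs = ev-comp (evv-∷ ev-zer evv-[]) ev-scc

  eval-pred : ∀ x → Eval A `pred (x ∷ []) (pred x)
  eval-pred zero    = ev-prec0 ev-zer
  eval-pred (suc x) = ev-precS (eval-pred x) (ev-proj (# 0))

  eval-ifz : ∀ {n} {a b c : PR n} {xs : Vec ℕ n} {va vb vc} →
             Eval A a xs va → Eval A b xs vb → Eval A c xs vc → Eval A (`ifz a b c) xs (ifz va vb vc)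
  eval-ifz {b = b} {c} {xs} {va} {vb} {vc} ea eb ec = ev-comp (evv-∷ ea (eval-shift [] xs)) (cases va)
    where
    cases : ∀ k → Eval A (prec b (comp c (shift 2))) (k ∷ xs) (ifz k vb vc)
    cases zero    = ev-prec0 eb
    cases (suc k) = ev-precS (cases k) (ev-comp (eval-shift (_ ∷ _ ∷ []) xs) ec)

  eval-add : ∀ k x → Eval A `add (k ∷ x ∷ []) (k + x)
  eval-add zero    x = ev-prec0 (ev-proj (# 0))
  eval-add (suc k) x = ev-precS (eval-add k x) (ev-comp (evv-∷ (ev-proj (# 1)) evv-[]) ev-scc)

  eval-monus : ∀ y x → Eval A `monus (y ∷ x ∷ []) (x ∸ y)
  eval-monus zero    x = ev-prec0 (ev-proj (# 0))
  eval-monus (suc y) x = subst (Eval A `monus (suc y ∷ x ∷ [])) (pred[m∸n]≡m∸[1+n] x y)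
    (ev-precS (eval-monus y x) (ev-comp (evv-∷ (ev-proj (# 1)) evv-[]) (eval-pred _)))

  eval-dist : ∀ {n} {a b : PR n} {xs va vb} → Eval A a xs va → Eval A b xs vb →
              Eval A (`dist a b) xs ((va ∸ vb) + (vb ∸ va))
  eval-dist ea eb = ev-comp (evv-∷ (ev-comp (evv-∷ eb (evv-∷ ea evv-[])) (eval-monus _ _))
                            (evv-∷ (ev-comp (evv-∷ ea (evv-∷ eb evv-[])) (eval-monus _ _)) evv-[]))
                            (eval-add _ _)

  eval-tri : ∀ k → Eval A `tri (k ∷ []) (tri k)
  eval-tri zero    = ev-prec0 ev-zer
  eval-tri (suc k) = ev-precS (eval-tri k)
    (ev-comp (evv-∷ (ev-comp (evv-∷ (ev-proj (# 1)) (evv-∷ (ev-proj (# 0)) evv-[])) (eval-add _ _)) evv-[]) ev-scc)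

  eval-pair : ∀ z x → Eval A `pair (z ∷ x ∷ []) (pair z x)
  eval-pair z x =
    ev-comp (evv-∷ (ev-comp (evv-∷ (ev-comp (evv-∷ (ev-proj (# 0)) (evv-∷ (ev-proj (# 1)) evv-[])) (eval-add z x))
                                   evv-[])
                            (eval-tri _))
                   (evv-∷ (ev-proj (# 1)) evv-[]))
            (eval-add _ _)

  eval-query : ∀ {n} {a b : PR n} {xs va vb} → Eval A a xs va → Eval A b xs vb →
               Eval A (`query a b) xs (χ (A (pair va vb)))
  eval-query ea eb = ev-comp (evv-∷ (ev-comp (evv-∷ ea (evv-∷ eb evv-[])) (eval-pair _ _)) evv-[]) ev-orc

  eval-anyRootBelow : ∀ {n} {f : PR (suc n)} {F} → Computes f F →
                      ∀ k xs → Eval A (`anyRootBelow f) (k ∷ xs) (anyRootBelow (λ i → F (i ∷ xs)) k)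
  eval-anyRootBelow cf zero    xs = ev-prec0 (eval-one _)
  eval-anyRootBelow cf (suc k) xs = ev-precS (eval-anyRootBelow cf k xs)
    (eval-ifz (ev-proj (# 1)) ev-zer (ev-comp (evv-∷ (ev-proj (# 0)) (eval-shift (_ ∷ _ ∷ []) xs)) (cf _)))

  eval-μ-search : ∀ {n} {f : PR (suc n)} {xs y} → Eval A f (y ∷ xs) 0 →
                  (∀ i → i < y → ∃ λ k → Eval A f (i ∷ xs) (suc k)) → Eval A (mu f) xs y
  eval-μ-search {f = f} {xs} {y} root nonzero = ev-mu (from y 0 (+-identityʳ y))
    where
    from : ∀ d i → d + i ≡ y → MuFrom A f xs i y
    from zero    i refl = mu-stop root
    from (suc d) i eq   = mu-step (proj₂ (nonzero i (subst (i <_) eq (s≤s (m≤n+m i d)))))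
                                  (from d (suc i) (trans (+-suc d i) eq))

  eval-μ : ∀ {n} {f : PR (suc n)} {F xs} → Computes f F →
           (r : LeastRoot (λ i → F (i ∷ xs))) → Eval A (mu f) xs (proj₁ r)
  eval-μ {F = F} {xs} cf (y , Fy≡0 , nonzero) =
    eval-μ-search (subst (Eval A _ _) Fy≡0 (cf _))
      λ i i<y → pred (F (i ∷ xs)) , subst (Eval A _ _) (sym (suc-pred _ {{≢-nonZero (nonzero i i<y)}})) (cf _)

  computable-∘ : ∀ {f g} → Computable A f → Computable A g → Computable A (λ x → f (g x))
  computable-∘ (`f , ef) (`g , eg) = comp `f (`g ∷ []) , λ x → ev-comp (evv-∷ (eg x) evv-[]) (ef _)

  computable-fold : ∀ {s} → Computable A s → Computable A (fold (s 0) s)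
  computable-fold {s} (`s , es) = prec (comp `s (zer ∷ [])) (comp `s (proj (# 1) ∷ [])) , evaluate
    where
    evaluate : ∀ k → Eval A (prec (comp `s (zer ∷ [])) (comp `s (proj (# 1) ∷ []))) (k ∷ []) (fold (s 0) s k)
    evaluate zero    = ev-prec0 (ev-comp (evv-∷ ev-zer evv-[]) (es 0))
    evaluate (suc k) = ev-precS (evaluate k) (ev-comp (evv-∷ (ev-proj (# 1)) evv-[]) (es _))

-- Step-bounded evaluation

-- State of a search after candidate j, given the previous state s and the clocked
-- value v at j: 0 = some candidate did not halt in time, 1 = searching, 2 + y = root y.
scanStep : ℕ → ℕ → ℕ → ℕ
scanStep j s v = ifz s 0 (ifz (pred s) (ifz v 0 (ifz (pred v) (suc (suc j)) 1)) s)

scanStep≡1 : ∀ j s v → scanStep j s v ≡ 1 → s ≡ 1 × ∃ λ k → v ≡ suc (suc k)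
scanStep≡1 j zero          v             ()
scanStep≡1 j (suc zero)    zero          ()
scanStep≡1 j (suc zero)    (suc zero)    ()
scanStep≡1 j (suc zero)    (suc (suc k)) refl = refl , k , refl
scanStep≡1 j (suc (suc s)) v             ()

scanStep≡2+ : ∀ j s v {y} → scanStep j s v ≡ suc (suc y) → s ≡ suc (suc y) ⊎ (s ≡ 1 × v ≡ 1 × y ≡ j)
scanStep≡2+ j zero          v             ()
scanStep≡2+ j (suc zero)    zero          ()
scanStep≡2+ j (suc zero)    (suc zero)    refl = inj₂ (refl , refl , refl)
scanStep≡2+ j (suc zero)    (suc (suc k)) ()
scanStep≡2+ j (suc (suc s)) v             refl = inj₁ refl

-- On t ∷ xs, `clocked c returns 1 + y when c halts on xs with value y once every unbounded
-- search is cut off after the candidates 0, …, t, and 0 when it does not; run t c xs is that value.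
mutual
  `clocked : ∀ {n} → PR n → PR (suc n)
  `clocked zer         = `one
  `clocked scc         = comp scc (comp scc (proj (# 1) ∷ []) ∷ [])
  `clocked (proj i)    = comp scc (proj (Fin.suc i) ∷ [])
  `clocked orc         = comp scc (comp orc (proj (# 1) ∷ []) ∷ [])
  `clocked (comp f gs) = `ifAllHalt gs (comp (`clocked f) (proj (# 0) ∷ `results gs))
  `clocked (prec g h)  = comp (prec (`clocked g) (`clockedRecStep h)) (proj (# 1) ∷ proj (# 0) ∷ shift 2)
  `clocked (mu f)      = comp `pred (comp (`scan f) (proj (# 0) ∷ proj (# 0) ∷ shift 1) ∷ [])

  `ifAllHalt : ∀ {n m} → Vec (PR n) m → PR (suc n) → PR (suc n)
  `ifAllHalt []       body = body
  `ifAllHalt (g ∷ gs) body = `ifz (`clocked g) zer (`ifAllHalt gs body)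

  `results : ∀ {n m} → Vec (PR n) m → Vec (PR (suc n)) m
  `results []       = []
  `results (g ∷ gs) = comp `pred (`clocked g ∷ []) ∷ `results gs

  `clockedRecStep : ∀ {n} → PR (suc (suc n)) → PR (suc (suc (suc n)))
  `clockedRecStep h = `ifz (proj (# 1)) zer
    (comp (`clocked h) (proj (# 2) ∷ proj (# 0) ∷ comp `pred (proj (# 1) ∷ []) ∷ shift 3))

  `scan : ∀ {n} → PR (suc n) → PR (suc (suc n))
  `scan f = prec (comp (`scanStep f) (zer ∷ `one ∷ proj (# 0) ∷ shift 1))
                 (comp (`scanStep f) (comp scc (proj (# 0) ∷ []) ∷ proj (# 1) ∷ proj (# 2) ∷ shift 3))

  `scanStep : ∀ {n} → PR (suc n) → PR (suc (suc (suc n)))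
  `scanStep f = `ifz (proj (# 1)) zer
    (`ifz (comp `pred (proj (# 1) ∷ []))
          (`ifz (`candidate f) zer
                (`ifz (comp `pred (`candidate f ∷ [])) (comp scc (comp scc (proj (# 0) ∷ []) ∷ [])) `one))
          (proj (# 1)))

  `candidate : ∀ {n} → PR (suc n) → PR (suc (suc (suc n)))
  `candidate f = comp (`clocked f) (proj (# 2) ∷ proj (# 0) ∷ shift 3)

module Clocked (A : Oracle) where
  open Programs A

  mutual
    run : ∀ {n} → ℕ → PR n → Vec ℕ n → ℕ
    run t zer         xs       = 1
    run t scc         (x ∷ []) = suc (suc x)
    run t (proj i)    xs       = suc (lookup xs i)
    run t orc         (x ∷ []) = suc (if A x then 1 else 0)
    run t (comp f gs) xs       = runIfAllHalt t gs xs (run t f (runResults t gs xs))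
    run t (prec g h)  (k ∷ xs) = runRec t g h k xs
    run t (mu f)      xs       = pred (runScan t f xs t)

    runIfAllHalt : ∀ {n m} → ℕ → Vec (PR n) m → Vec ℕ n → ℕ → ℕ
    runIfAllHalt t []       xs v = v
    runIfAllHalt t (g ∷ gs) xs v = ifz (run t g xs) 0 (runIfAllHalt t gs xs v)

    runResults : ∀ {n m} → ℕ → Vec (PR n) m → Vec ℕ n → Vec ℕ m
    runResults t []       xs = []
    runResults t (g ∷ gs) xs = pred (run t g xs) ∷ runResults t gs xs

    runRec : ∀ {n} → ℕ → PR n → PR (suc (suc n)) → ℕ → Vec ℕ n → ℕ
    runRec t g h zero    xs = run t g xs
    runRec t g h (suc k) xs = ifz (runRec t g h k xs) 0 (run t h (k ∷ pred (runRec t g h k xs) ∷ xs))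

    runScan : ∀ {n} → ℕ → PR (suc n) → Vec ℕ n → ℕ → ℕ
    runScan t f xs zero    = scanStep 0 1 (run t f (0 ∷ xs))
    runScan t f xs (suc j) = scanStep (suc j) (runScan t f xs j) (run t f (suc j ∷ xs))

  mutual
    eval-clocked : ∀ {n} (c : PR n) t xs → Eval A (`clocked c) (t ∷ xs) (run t c xs)
    eval-clocked zer         t xs       = eval-one _
    eval-clocked scc         t (x ∷ []) = ev-comp (evv-∷ (ev-comp (evv-∷ (ev-proj (# 1)) evv-[]) ev-scc) evv-[]) ev-scc
    eval-clocked (proj i)    t xs       = ev-comp (evv-∷ (ev-proj (Fin.suc i)) evv-[]) ev-scc
    eval-clocked orc         t (x ∷ []) = ev-comp (evv-∷ (ev-comp (evv-∷ (ev-proj (# 1)) evv-[]) ev-orc) evv-[]) ev-scc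
    eval-clocked (comp f gs) t xs       =
      eval-ifAllHalt gs t xs (ev-comp (evv-∷ (ev-proj (# 0)) (eval-results gs t xs)) (eval-clocked f t _))
    eval-clocked (prec g h)  t (k ∷ xs) =
      ev-comp (evv-∷ (ev-proj (# 1)) (evv-∷ (ev-proj (# 0)) (eval-shift (t ∷ k ∷ []) xs)))
              (eval-clockedRec g h t xs k)
    eval-clocked (mu f)      t xs       =
      ev-comp (evv-∷ (ev-comp (evv-∷ (ev-proj (# 0)) (evv-∷ (ev-proj (# 0)) (eval-shift (t ∷ []) xs)))
                              (eval-scan f t xs t)) evv-[])
              (eval-pred _)

    eval-ifAllHalt : ∀ {n m} (gs : Vec (PR n) m) t xs {body v} → Eval A body (t ∷ xs) v →
                     Eval A (`ifAllHalt gs body) (t ∷ xs) (runIfAllHalt t gs xs v)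
    eval-ifAllHalt []       t xs e = e
    eval-ifAllHalt (g ∷ gs) t xs e = eval-ifz (eval-clocked g t xs) ev-zer (eval-ifAllHalt gs t xs e)

    eval-results : ∀ {n m} (gs : Vec (PR n) m) t xs → EvalVec A (`results gs) (t ∷ xs) (runResults t gs xs)
    eval-results []       t xs = evv-[]
    eval-results (g ∷ gs) t xs =
      evv-∷ (ev-comp (evv-∷ (eval-clocked g t xs) evv-[]) (eval-pred _)) (eval-results gs t xs)

    eval-clockedRec : ∀ {n} (g : PR n) h t xs k →
                      Eval A (prec (`clocked g) (`clockedRecStep h)) (k ∷ t ∷ xs) (runRec t g h k xs)
    eval-clockedRec g h t xs zero    = ev-prec0 (eval-clocked g t xs)
    eval-clockedRec g h t xs (suc k) = ev-precS (eval-clockedRec g h t xs k)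
      (eval-ifz (ev-proj (# 1)) ev-zer
        (ev-comp (evv-∷ (ev-proj (# 2)) (evv-∷ (ev-proj (# 0))
                   (evv-∷ (ev-comp (evv-∷ (ev-proj (# 1)) evv-[]) (eval-pred _)) (eval-shift (_ ∷ _ ∷ _ ∷ []) xs))))
                 (eval-clocked h t _)))

    eval-scan : ∀ {n} (f : PR (suc n)) t xs j → Eval A (`scan f) (j ∷ t ∷ xs) (runScan t f xs j)
    eval-scan f t xs zero    =
      ev-prec0 (ev-comp (evv-∷ ev-zer (evv-∷ (eval-one _) (evv-∷ (ev-proj (# 0)) (eval-shift (t ∷ []) xs))))
                        (eval-scanStep f t xs 0 1))
    eval-scan f t xs (suc j) = ev-precS (eval-scan f t xs j)
      (ev-comp (evv-∷ (ev-comp (evv-∷ (ev-proj (# 0)) evv-[]) ev-scc)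
                      (evv-∷ (ev-proj (# 1)) (evv-∷ (ev-proj (# 2)) (eval-shift (_ ∷ _ ∷ _ ∷ []) xs))))
               (eval-scanStep f t xs (suc j) _))

    eval-scanStep : ∀ {n} (f : PR (suc n)) t xs j s →
                    Eval A (`scanStep f) (j ∷ s ∷ t ∷ xs) (scanStep j s (run t f (j ∷ xs)))
    eval-scanStep f t xs j s = eval-ifz (ev-proj (# 1)) ev-zer
      (eval-ifz (ev-comp (evv-∷ (ev-proj (# 1)) evv-[]) (eval-pred _))
        (eval-ifz candidate ev-zer
          (eval-ifz (ev-comp (evv-∷ candidate evv-[]) (eval-pred _))
                    (ev-comp (evv-∷ (ev-comp (evv-∷ (ev-proj (# 0)) evv-[]) ev-scc) evv-[]) ev-scc)
                    (eval-one _)))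
        (ev-proj (# 1)))
      where
      candidate : Eval A (`candidate f) (j ∷ s ∷ t ∷ xs) (run t f (j ∷ xs))
      candidate = ev-comp (evv-∷ (ev-proj (# 2)) (evv-∷ (ev-proj (# 0)) (eval-shift (_ ∷ _ ∷ _ ∷ []) xs)))
                          (eval-clocked f t _)

  RunsToNonzero : ∀ {n} → ℕ → PR (suc n) → Vec ℕ n → ℕ → Set
  RunsToNonzero t f xs i = ∃ λ k → run t f (i ∷ xs) ≡ suc (suc k)

  SearchFrom : ∀ {n} → ℕ → PR (suc n) → Vec ℕ n → ℕ → ℕ → Set
  SearchFrom t f xs i y = (∀ j → i ≤ j → j < y → RunsToNonzero t f xs j) × run t f (y ∷ xs) ≡ 1

  runScan≡1⇒searching : ∀ {n} t (f : PR (suc n)) xs j → runScan t f xs j ≡ 1 →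
                        ∀ i → i ≤ j → RunsToNonzero t f xs i
  runScan≡1⇒searching t f xs zero    eq i z≤n = proj₂ (scanStep≡1 0 1 (run t f (0 ∷ xs)) eq)
  runScan≡1⇒searching t f xs (suc j) eq i i≤1+j
    with prev≡1 , halted ← scanStep≡1 (suc j) _ (run t f (suc j ∷ xs)) eq
    with m≤n⇒m<n∨m≡n i≤1+j
  ... | inj₁ i<1+j = runScan≡1⇒searching t f xs j prev≡1 i (m<1+n⇒m≤n i<1+j)
  ... | inj₂ refl  = halted

  runScan≡2+⇒search : ∀ {n} t (f : PR (suc n)) xs j {y} → runScan t f xs j ≡ suc (suc y) → SearchFrom t f xs 0 y
  runScan≡2+⇒search t f xs zero eq with scanStep≡2+ 0 1 (run t f (0 ∷ xs)) eq
  ... | inj₂ (_ , v≡1 , refl) = (λ _ _ ()) , v≡1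
  runScan≡2+⇒search t f xs (suc j) eq with scanStep≡2+ (suc j) _ (run t f (suc j ∷ xs)) eq
  ... | inj₁ prev                   = runScan≡2+⇒search t f xs j prev
  ... | inj₂ (prev≡1 , v≡1 , refl) =
    (λ i _ i<1+j → runScan≡1⇒searching t f xs j prev≡1 i (m<1+n⇒m≤n i<1+j)) , v≡1

  runScan-searching : ∀ {n} t (f : PR (suc n)) xs {y} → SearchFrom t f xs 0 y →
                      ∀ j → j < y → runScan t f xs j ≡ 1
  runScan-searching t f xs (nonzero , _) zero    0<y   = cong (scanStep 0 1) (proj₂ (nonzero 0 z≤n 0<y))
  runScan-searching t f xs search        (suc j) 1+j<y =
    cong₂ (scanStep (suc j)) (runScan-searching t f xs search j (<-trans (n<1+n j) 1+j<y))
                             (proj₂ (proj₁ search (suc j) z≤n 1+j<y))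

  runScan-found : ∀ {n} t (f : PR (suc n)) xs {y} → SearchFrom t f xs 0 y →
                  ∀ j → y ≤ j → runScan t f xs j ≡ suc (suc y)
  runScan-found t f xs (_ , root) zero z≤n = cong (scanStep 0 1) root
  runScan-found t f xs search (suc j) y≤1+j with m≤n⇒m<n∨m≡n y≤1+j
  ... | inj₁ y<1+j = cong (λ s → scanStep (suc j) s (run t f (suc j ∷ xs)))
                          (runScan-found t f xs search j (m<1+n⇒m≤n y<1+j))
  ... | inj₂ refl  = cong₂ (scanStep (suc j)) (runScan-searching t f xs search j ≤-refl) (proj₂ search)

  mutual
    run-sound : ∀ {n} (c : PR n) t xs {y} → run t c xs ≡ suc y → Eval A c xs y
    run-sound zer         t xs       refl = ev-zer
    run-sound scc         t (x ∷ []) refl = ev-scc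
    run-sound (proj i)    t xs       refl = ev-proj i
    run-sound orc         t (x ∷ []) refl = ev-orc
    run-sound (comp f gs) t xs       eq
      with args , body ← runIfAllHalt-sound gs t xs eq = ev-comp args (run-sound f t _ body)
    run-sound (prec g h)  t (k ∷ xs) eq   = runRec-sound g h t xs k eq
    run-sound (mu f)      t xs       eq   with runScan t f xs t in scan
    ... | suc (suc y) with refl ← eq with nonzero , root ← runScan≡2+⇒search t f xs t scan =
      eval-μ-search (run-sound f t _ root) λ i i<y → let k , ran = nonzero i z≤n i<y in k , run-sound f t _ ran

    runRec-sound : ∀ {n} (g : PR n) h t xs k {y} → runRec t g h k xs ≡ suc y → Eval A (prec g h) (k ∷ xs) y
    runRec-sound g h t xs zero    eq = ev-prec0 (run-sound g t xs eq)
    runRec-sound g h t xs (suc k) eq with runRec t g h k xs in prev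
    ... | suc z = ev-precS (runRec-sound g h t xs k prev) (run-sound h t _ eq)

    runIfAllHalt-sound : ∀ {n m} (gs : Vec (PR n) m) t xs {v y} → runIfAllHalt t gs xs v ≡ suc y →
                         EvalVec A gs xs (runResults t gs xs) × v ≡ suc y
    runIfAllHalt-sound []       t xs eq = evv-[] , eq
    runIfAllHalt-sound (g ∷ gs) t xs eq with run t g xs in ran
    ... | suc a with args , body ← runIfAllHalt-sound gs t xs eq = evv-∷ (run-sound g t xs ran) args , body

  ResultsHalt : ∀ {n m} → ℕ → Vec (PR n) m → Vec ℕ n → Vec ℕ m → Set
  ResultsHalt t gs xs ys = runResults t gs xs ≡ ys × (∀ v → runIfAllHalt t gs xs v ≡ v)

  mutual
    run-complete : ∀ {n} {c : PR n} {xs y} → Eval A c xs y → Eventually (λ t → run t c xs ≡ suc y)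
    run-complete ev-zer      = 0 , λ _ _ → refl
    run-complete ev-scc      = 0 , λ _ _ → refl
    run-complete (ev-proj i) = 0 , λ _ _ → refl
    run-complete ev-orc      = 0 , λ _ _ → refl
    run-complete {c = comp f gs} {xs} {y} (ev-comp {ys = ys} args e) =
      eventually-map combine (eventually-× (results-complete args) (run-complete e))
      where
      combine : ∀ {t} → ResultsHalt t gs xs ys × run t f ys ≡ suc y → run t (comp f gs) xs ≡ suc y
      combine ((results , halted) , ran) = trans (halted _) (trans (cong (run _ f) results) ran)
    run-complete (ev-prec0 e) = run-complete e
    run-complete {c = prec g h} {_ ∷ xs} {y} (ev-precS {k = k} {z} e eh) =
      eventually-map combine (eventually-× (run-complete e) (run-complete eh))
      where
      combine : ∀ {t} → runRec t g h k xs ≡ suc z × run t h (k ∷ z ∷ xs) ≡ suc y →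
                runRec t g h (suc k) xs ≡ suc y
      combine (prev , ran) rewrite prev = ran
    run-complete {c = mu f} {xs} {y} (ev-mu search) =
      eventually-map combine (eventually-× (search-complete search) (y , λ _ y≤t → y≤t))
      where
      combine : ∀ {t} → SearchFrom t f xs 0 y × y ≤ t → run t (mu f) xs ≡ suc y
      combine {t} (found , y≤t) = cong pred (runScan-found t f xs found t y≤t)

    results-complete : ∀ {n m} {gs : Vec (PR n) m} {xs ys} → EvalVec A gs xs ys →
                       Eventually (λ t → ResultsHalt t gs xs ys)
    results-complete evv-[] = 0 , λ _ _ → refl , λ _ → refl
    results-complete {gs = g ∷ gs} {xs} {y ∷ ys} (evv-∷ e args) =
      eventually-map combine (eventually-× (run-complete e) (results-complete args))
      where
      combine : ∀ {t} → run t g xs ≡ suc y × ResultsHalt t gs xs ys → ResultsHalt t (g ∷ gs) xs (y ∷ ys)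
      combine (ran , results , halted) rewrite ran = cong (y ∷_) results , halted

    search-complete : ∀ {n} {f : PR (suc n)} {xs i y} → MuFrom A f xs i y →
                      Eventually (λ t → SearchFrom t f xs i y)
    search-complete (mu-stop e) =
      eventually-map (λ ran → (λ j i≤j j<i → ⊥-elim (<-irrefl refl (≤-<-trans i≤j j<i))) , ran) (run-complete e)
    search-complete {f = f} {xs} {i} {y} (mu-step {k = k} e rest) =
      eventually-map combine (eventually-× (run-complete e) (search-complete rest))
      where
      combine : ∀ {t} → run t f (i ∷ xs) ≡ suc (suc k) × SearchFrom t f xs (suc i) y → SearchFrom t f xs i y
      combine {t} (ran , nonzero , root) = nonzero′ , root
        where
        nonzero′ : ∀ j → i ≤ j → j < y → RunsToNonzero t f xs j
        nonzero′ j i≤j j<y with m≤n⇒m<n∨m≡n i≤j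
        ... | inj₁ i<j = nonzero j i<j j<y
        ... | inj₂ refl = k , ran

-- Enumerating an infinite c.e. set

module Successor (A : Oracle) (e : PR 1) (infinite : Infinite (W A e)) where
  open Programs A
  open Clocked A

  -- 0 iff e halts on w within budget s and b < w
  found : Vec ℕ 3 → ℕ
  found (w ∷ s ∷ b ∷ []) = ifz (run s e (w ∷ [])) 1 (suc b ∸ w)

  `found : PR 3
  `found = `ifz (comp (`clocked e) (proj (# 1) ∷ proj (# 0) ∷ []))
                `one
                (comp `monus (proj (# 0) ∷ comp scc (proj (# 2) ∷ []) ∷ []))

  eval-found : Computes `found found
  eval-found (w ∷ s ∷ b ∷ []) =
    eval-ifz (ev-comp (evv-∷ (ev-proj (# 1)) (evv-∷ (ev-proj (# 0)) evv-[])) (eval-clocked e s _))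
             (eval-one _)
             (ev-comp (evv-∷ (ev-proj (# 0)) (evv-∷ (ev-comp (evv-∷ (ev-proj (# 2)) evv-[]) ev-scc) evv-[]))
                      (eval-monus _ _))

  found≡0 : ∀ w s b → found (w ∷ s ∷ b ∷ []) ≡ 0 → (∃ λ y → run s e (w ∷ []) ≡ suc y) × b < w
  found≡0 w s b eq with run s e (w ∷ []) in ran
  ... | suc y = (y , refl) , m∸n≡0⇒m≤n eq

  foundBelow : Vec ℕ 2 → ℕ
  foundBelow (s ∷ b ∷ []) = anyRootBelow (λ w → found (w ∷ s ∷ b ∷ [])) s

  `foundBelow : PR 2
  `foundBelow = comp (`anyRootBelow `found) (proj (# 0) ∷ proj (# 0) ∷ proj (# 1) ∷ [])

  eval-foundBelow : Computes `foundBelow foundBelow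
  eval-foundBelow (s ∷ b ∷ []) =
    ev-comp (evv-∷ (ev-proj (# 0)) (evv-∷ (ev-proj (# 0)) (evv-∷ (ev-proj (# 1)) evv-[])))
            (eval-anyRootBelow eval-found s (s ∷ b ∷ []))

  stage : ∀ b → LeastRoot (λ s → foundBelow (s ∷ b ∷ []))
  stage b with w , b<w , y , halts ← infinite (suc b) with T , ran ← run-complete halts =
    leastRoot (s , anyRootBelow-root (λ w → found (w ∷ s ∷ b ∷ [])) found-w (m≤n⊔m T (suc w)))
    where
    s : ℕ
    s = T ⊔ suc w
    found-w : found (w ∷ s ∷ b ∷ []) ≡ 0
    found-w rewrite ran s (m≤m⊔n T (suc w)) = m≤n⇒m∸n≡0 b<w

  foundAtStage : Vec ℕ 2 → ℕ
  foundAtStage (w ∷ b ∷ []) = found (w ∷ proj₁ (stage b) ∷ b ∷ [])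

  `foundAtStage : PR 2
  `foundAtStage = comp `found (proj (# 0) ∷ comp (mu `foundBelow) (proj (# 1) ∷ []) ∷ proj (# 1) ∷ [])

  eval-foundAtStage : Computes `foundAtStage foundAtStage
  eval-foundAtStage (w ∷ b ∷ []) =
    ev-comp (evv-∷ (ev-proj (# 0))
              (evv-∷ (ev-comp (evv-∷ (ev-proj (# 1)) evv-[]) (eval-μ eval-foundBelow (stage b)))
                (evv-∷ (ev-proj (# 1)) evv-[])))
            (eval-found _)

  next : ∀ b → LeastRoot (λ w → foundAtStage (w ∷ b ∷ []))
  next b with s , somewhere , _ ← stage b =
    leastRoot (anyRootBelow≡0⇒root (λ w → found (w ∷ s ∷ b ∷ [])) s somewhere)

  next-in-W : ∀ b → b < proj₁ (next b) × W A e (proj₁ (next b))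
  next-in-W b with (y , ran) , b<w ← found≡0 _ _ b (proj₁ (proj₂ (next b))) = b<w , y , run-sound e _ _ ran

infiniteCE⇒computableSuccessor : ∀ A e → Infinite (W A e) →
  Σ (ℕ → ℕ) λ next → Computable A next × (∀ b → b < next b × W A e (next b))
infiniteCE⇒computableSuccessor A e infinite =
  (λ b → proj₁ (next b)) , (mu `foundAtStage , λ b → eval-μ eval-foundAtStage (next b)) , next-in-W
  where
  open Programs A
  open Successor A e infinite

-- Least elements of equivalence classes

module ClassMinimum (R : ℕ → ℕ → Bool) (R-equiv : IsEquivRel R) where
  open IsEquivRel R-equiv renaming (refl to R-refl; sym to R-sym; trans to R-trans)
  open Programs (asSet R)

  unrelated : Vec ℕ 2 → ℕ
  unrelated (z ∷ x ∷ []) = ifz (χ (R z x)) 1 0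

  unrelated≡0⇒related : ∀ z x → unrelated (z ∷ x ∷ []) ≡ 0 → R z x ≡ true
  unrelated≡0⇒related z x eq with R z x
  ... | true = refl

  related⇒unrelated≡0 : ∀ {z x} → R z x ≡ true → unrelated (z ∷ x ∷ []) ≡ 0
  related⇒unrelated≡0 Rzx rewrite Rzx = refl

  classMinimum : ∀ x → LeastRoot (λ z → unrelated (z ∷ x ∷ []))
  classMinimum x = leastRoot (x , related⇒unrelated≡0 (R-refl x))

  classMin : ℕ → ℕ
  classMin x = proj₁ (classMinimum x)

  classMin-related : ∀ x → R (classMin x) x ≡ true
  classMin-related x = unrelated≡0⇒related _ x (proj₁ (proj₂ (classMinimum x)))

  classMin-least : ∀ x {z} → z < classMin x → R z x ≢ true
  classMin-least x z<min Rzx = proj₂ (proj₂ (classMinimum x)) _ z<min (related⇒unrelated≡0 Rzx)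

  classMin-cong : ∀ {x y} → R x y ≡ true → classMin x ≡ classMin y
  classMin-cong {x} {y} Rxy = ≤-antisym
    (≮⇒≥ λ y<x → classMin-least x y<x (R-trans _ _ _ (classMin-related y) (R-sym _ _ Rxy)))
    (≮⇒≥ λ x<y → classMin-least y x<y (R-trans _ _ _ (classMin-related x) Rxy))

  classMin-≡⇒related : ∀ {x y} → classMin x ≡ classMin y → R x y ≡ true
  classMin-≡⇒related {x} {y} same =
    R-trans _ _ _ (R-sym _ _ (classMin-related x)) (subst (λ m → R m y ≡ true) (sym same) (classMin-related y))

  classMin-related⇒related : ∀ {x y} → R (classMin x) (classMin y) ≡ true → R x y ≡ true
  classMin-related⇒related {x} {y} minima =
    R-trans _ _ _ (R-sym _ _ (classMin-related x)) (R-trans _ _ _ minima (classMin-related y))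

  classMin-idempotent : ∀ x → classMin (classMin x) ≡ classMin x
  classMin-idempotent x = classMin-cong (classMin-related x)

  `unrelated : PR 2
  `unrelated = `ifz (`query (proj (# 0)) (proj (# 1))) `one zer

  eval-unrelated : Computes `unrelated unrelated
  eval-unrelated (z ∷ x ∷ []) =
    eval-ifz (subst (Eval (asSet R) _ _) (cong χ (asSet-pair R z x)) (eval-query (ev-proj (# 0)) (ev-proj (# 1))))
             (eval-one _) ev-zer

  `classMin : PR 1
  `classMin = mu `unrelated

  eval-classMin : ∀ x → Eval (asSet R) `classMin (x ∷ []) (classMin x)
  eval-classMin x = eval-μ eval-unrelated (classMinimum x)

-- Reductions and independent c.e. sets

Independent : (ℕ → ℕ → Bool) → (ℕ → Set) → Set
Independent R P = ∀ u v → P u → P v → u ≢ v → R u v ≡ false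

HasIndependentCE : Oracle → (ℕ → ℕ → Bool) → Set
HasIndependentCE A R = Σ (PR 1) λ e → Infinite (W A e) × Independent R (W A e)

separatedSequence : ∀ {R} → InfClasses R → Σ (ℕ → ℕ) λ s → ∀ {i j} → i < j → R (s j) (s i) ≡ false
separatedSequence {R} classes = new , λ {i} {j} i<j → All.lookup (proj₂ (classes (chosen j))) (new∈chosen i<j)
  where
  chosen : ℕ → List ℕ
  new : ℕ → ℕ
  chosen zero    = []
  chosen (suc k) = new k ∷ chosen k
  new k = proj₁ (classes (chosen k))

  new∈chosen : ∀ {i j} → i < j → new i ∈ chosen j
  new∈chosen {i} {suc j} i<1+j with m<1+n⇒m<n∨m≡n i<1+j
  ... | inj₁ i<j = there (new∈chosen i<j)
  ... | inj₂ refl = here refl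

module ImageOfClassMinima (R S : ℕ → ℕ → Bool) (R-equiv : IsEquivRel R) (S-equiv : IsEquivRel S)
                          (classes : InfClasses R) (f : ℕ → ℕ) (`f : PR 1)
                          (eval-f : ∀ x → Eval (asSet R) `f (x ∷ []) (f x))
                          (reduction : ∀ x y → R x y ≡ S (f x) (f y)) where
  open Programs (asSet R)
  open ClassMinimum R R-equiv

  mismatch : Vec ℕ 2 → ℕ
  mismatch (x ∷ u ∷ []) = ((f x ∸ u) + (u ∸ f x)) + ((classMin x ∸ x) + (x ∸ classMin x))

  `mismatch : PR 2
  `mismatch = comp `add (`dist (comp `f (proj (# 0) ∷ [])) (proj (# 1)) ∷
                         `dist (comp `classMin (proj (# 0) ∷ [])) (proj (# 0)) ∷ [])

  eval-mismatch : Computes `mismatch mismatch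
  eval-mismatch (x ∷ u ∷ []) =
    ev-comp (evv-∷ (eval-dist (ev-comp (evv-∷ (ev-proj (# 0)) evv-[]) (eval-f x)) (ev-proj (# 1)))
              (evv-∷ (eval-dist (ev-comp (evv-∷ (ev-proj (# 0)) evv-[]) (eval-classMin x)) (ev-proj (# 0))) evv-[]))
            (eval-add _ _)

  `image : PR 1
  `image = mu `mismatch

  Image : ℕ → Set
  Image = W (asSet R) `image

  Image⇒minimalPreimage : ∀ {u} → Image u → ∃ λ x → f x ≡ u × classMin x ≡ x
  Image⇒minimalPreimage {u} (x , ev-mu search) =
    x , dist≡0⇒≡ (f x) u (m+n≡0⇒m≡0 _ mismatch≡0)
      , dist≡0⇒≡ (classMin x) x (m+n≡0⇒n≡0 ((f x ∸ u) + (u ∸ f x)) mismatch≡0)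
    where
    mismatch≡0 : mismatch (x ∷ u ∷ []) ≡ 0
    mismatch≡0 = Eval-functional (eval-mismatch _) (MuFrom-root search)

  minimal⇒Image : ∀ {x} → classMin x ≡ x → Image (f x)
  minimal⇒Image {x} minimal = _ , eval-μ eval-mismatch (leastRoot (x , mismatch≡0))
    where
    mismatch≡0 : mismatch (x ∷ f x ∷ []) ≡ 0
    mismatch≡0 rewrite minimal | dist-self (f x) | dist-self x = refl

  Image-independent : Independent S Image
  Image-independent u v u∈ v∈ u≢v with x , refl , x-min ← Image⇒minimalPreimage u∈
                                   with y , refl , y-min ← Image⇒minimalPreimage v∈
                                   with S (f x) (f y) in Sfxfy
  ... | false = refl
  ... | true  = ⊥-elim (u≢v (cong f x≡y))
    where
    x≡y : x ≡ y
    x≡y = trans (sym x-min) (trans (classMin-cong (trans (reduction x y) Sfxfy)) y-min)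

  representatives : ℕ → ℕ
  representatives = proj₁ (separatedSequence classes)

  minimalImage : ℕ → ℕ
  minimalImage i = f (classMin (representatives i))

  minimalImage-separated : ∀ {i j} → i < j → minimalImage i ≢ minimalImage j
  minimalImage-separated {i} {j} i<j same =
    not-¬ (classMin-related⇒related minima-related) (proj₂ (separatedSequence classes) i<j)
    where
    minima-related : R (classMin (representatives j)) (classMin (representatives i)) ≡ true
    minima-related = trans (reduction _ _)
      (subst (λ v → S (minimalImage j) v ≡ true) (sym same) (IsEquivRel.refl S-equiv _))

  Image-infinite : Infinite Image
  Image-infinite n with i , n≤ ← separated⇒unbounded minimalImage minimalImage-separated n =
    minimalImage i , n≤ , minimal⇒Image (classMin-idempotent (representatives i))

reduces⇒independentCE : ∀ {R S} → IsEquivRel R → IsEquivRel S → InfClasses R →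
                        Reduces (asSet R) R S → HasIndependentCE (asSet R) S
reduces⇒independentCE {R} {S} R-equiv S-equiv classes (f , (`f , eval-f) , reduction) =
  `image , Image-infinite , Image-independent
  where open ImageOfClassMinima R S R-equiv S-equiv classes f `f eval-f reduction

independentCE⇒reduces : ∀ {R S} → IsEquivRel R → IsEquivRel S →
                        HasIndependentCE (asSet S) R → Reduces (asSet S) S R
independentCE⇒reduces {R} {S} R-equiv S-equiv (e , infinite , independent) =
  g , computable-∘ (computable-fold next-computable) (`classMin , eval-classMin) , reduction
  where
  open Programs (asSet S)
  open ClassMinimum S S-equiv
  open IsEquivRel R-equiv using () renaming (refl to R-refl)

  successor = infiniteCE⇒computableSuccessor (asSet S) e infinite
  next = proj₁ successor
  next-computable = proj₁ (proj₂ successor)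
  next-inflationary = λ b → proj₁ (proj₂ (proj₂ successor) b)

  enumeration : ℕ → ℕ
  enumeration = fold (next 0) next

  enumeration-in-W : ∀ k → W (asSet S) e (enumeration k)
  enumeration-in-W zero    = proj₂ (proj₂ (proj₂ successor) 0)
  enumeration-in-W (suc k) = proj₂ (proj₂ (proj₂ successor) (enumeration k))

  g : ℕ → ℕ
  g x = enumeration (classMin x)

  reduction : ∀ x y → S x y ≡ R (g x) (g y)
  reduction x y with S x y in Sxy
  ... | true  = sym (subst (λ m → R (g x) (enumeration m) ≡ true) (classMin-cong Sxy) (R-refl _))
  ... | false = sym (independent _ _ (enumeration-in-W (classMin x)) (enumeration-in-W (classMin y)) distinct)
    where
    distinct : g x ≢ g y
    distinct same = not-¬ (classMin-≡⇒related (fold-injective next (next 0) next-inflationary same)) Sxy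

proposition4p5 : ∀ (R S : ℕ → ℕ → Bool) → IsEquivRel R → IsEquivRel S →
                   (DIncomparable R S ⇔ MutuallyDark R S)
proposition4p5 R S R-equiv S-equiv = mk⇔ incomparable⇒dark dark⇒incomparable
  where
  incomparable⇒dark : DIncomparable R S → MutuallyDark R S
  incomparable⇒dark (R-classes , S-classes , R↛S , S↛R) =
    (R-classes , λ independent → S↛R (independentCE⇒reduces R-equiv S-equiv independent)) ,
    (S-classes , λ independent → R↛S (independentCE⇒reduces S-equiv R-equiv independent))

  dark⇒incomparable : MutuallyDark R S → DIncomparable R S
  dark⇒incomparable ((R-classes , R-dark) , (S-classes , S-dark)) =
    R-classes , S-classes ,
    (λ R→S → S-dark (reduces⇒independentCE R-equiv S-equiv R-classes R→S)) ,
    (λ S→R → R-dark (reduces⇒independentCE S-equiv R-equiv S-classes S→R))
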